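{- Let $n\geq 4$ and let $\mathcal{C}_n$ be the cycle of order $n$. Then $\chi_{lid}(\mathcal{C}_n)=3$ if $n\equiv 0 \pmod 4$; $\chi_{lid}(\mathcal{C}_n)=5$ if $n=5$ or $n=7$; and $\chi_{lid}(\mathcal{C}_n)=4$ otherwise. As a consequence, every finite simple graph with maximum degree $2$ has a locally identifying colouring with five colours.
   Context: For a vertex $u$, $N[u]$ is its closed neighbourhood (the vertex together with its neighbours); for a colouring $c$ and vertex set $S$, $c(S)=\{c(u):u\in S\}$. A locally identifying colouring (lid-colouring) is a proper vertex colouring $c$ such that for every pair of adjacent vertices $u,v$ with $N[u]\neq N[v]$, $c(N[u])\neq c(N[v])$. $\chi_{lid}(G)$ is the minimum number of colours in a lid-colouring of $G$. -}

module Defs where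

open import Data.Nat using (ℕ; zero; suc; _<_; _≤_)
open import Data.Fin using (Fin; toℕ)
open import Data.List using (List; length; filter)
open import Data.Product using (Σ; ∃; _×_; _,_)
open import Data.Sum using (_⊎_)
open import Relation.Nullary using (¬_)
open import Relation.Unary using (Decidable)
open import Relation.Binary.PropositionalEquality using (_≡_; _≢_)
import Data.List as L
import Data.Fin as F

_⟺_ : Set → Set → Set
A ⟺ B = (A → B) × (B → A)

module _ {n : ℕ} (Adj : Fin n → Fin n → Set) where

  InN : Fin n → Fin n → Set
  InN u w = w ≡ u ⊎ Adj u w

  SameNbhd : Fin n → Fin n → Set
  SameNbhd u v = ∀ w → InN u w ⟺ InN v w

  SameColours : {k : ℕ} → (Fin n → Fin k) → Fin n → Fin n → Set
  SameColours {k} c u v =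
    ∀ (x : Fin k) → (∃ λ w → InN u w × c w ≡ x) ⟺ (∃ λ w → InN v w × c w ≡ x)

  IsLid : {k : ℕ} → (Fin n → Fin k) → Set
  IsLid c =
    (∀ u v → Adj u v → c u ≢ c v)
    × (∀ u v → Adj u v → ¬ SameNbhd u v → ¬ SameColours c u v)

  ChiLid : ℕ → Set
  ChiLid k =
    (Σ (Fin n → Fin k) IsLid)
    × (∀ m → m < k → ¬ Σ (Fin n → Fin m) IsLid)

  degree : ((u : Fin n) → Decidable (Adj u)) → Fin n → ℕ
  degree adj? u = length (filter (adj? u) (L.allFin n))

  MaxDegree : ((u : Fin n) → Decidable (Adj u)) → ℕ → Set
  MaxDegree adj? d = (∀ u → degree adj? u ≤ d) × (∃ λ u → degree adj? u ≡ d)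

CycleAdj : (n : ℕ) → Fin n → Fin n → Set
CycleAdj n i j =
  (toℕ j ≡ suc (toℕ i)) ⊎ (toℕ i ≡ suc (toℕ j))
  ⊎ (toℕ i ≡ 0 × suc (toℕ j) ≡ n) ⊎ (toℕ j ≡ 0 × suc (toℕ i) ≡ n)

-- On a cycle, an edge uv with outer neighbours p and q has c(N[u]) = {c p, c u, c v} and
-- c(N[v]) = {c u, c v, c q}; for a proper colouring these differ iff c p ≠ c q and
-- (c p, c u) ≠ (c v, c q). So the lid colourings of C_n, n ≥ 4, are the cyclic words whose
-- four consecutive letters a b c d always satisfy a ≠ b, a ≠ d and (a, b) ≠ (c, d). Two letters
-- never suffice, three force period 4, and four fail on C₅ and C₇ by exhaustive search; the
-- upper bounds come from the words (0102)^a w for a few short seeds w.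
--
-- Graphs of maximum degree two are coloured by induction on the order. If a vertex v has at most
-- one neighbour, colour G - v and give v a colour avoiding the at most three vertices reached from
-- v by walks of length 1 to 3 that do not turn back; that colour separates every edge at v or at
-- its neighbour. Otherwise the component of vertex 0 is a cycle, recoloured with five colours.

module Submission where

open import Defs
open import Data.Nat as ℕ using (ℕ; zero; suc; _≤_; _<_; _%_; _+_; _*_; _∸_; z≤n; s≤s; NonZero)
import Data.Nat.Properties as ℕP
open import Data.Nat.DivMod
  using ( _mod_; _/_; m%n<n; m≡m%n+[m/n]*n; m<n⇒m%n≡m; n%n≡0; m%n%n≡m%n; %-distribˡ-+
        ; m≤n⇒[n∸m]%m≡n%m; [m+n]%n≡m%n)
open import Data.Fin as F using (Fin; zero; suc; toℕ; punchIn; punchOut; #_)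
open import Data.Vec.Functional using (_∷_; [])
import Data.Fin.Properties as FP
open import Data.Fin.Properties using (_≟_; any?; all?)
open import Data.Empty using (⊥; ⊥-elim)
open import Data.Product using (Σ; ∃; _×_; _,_; proj₁; proj₂)
open import Data.Sum as Sum using (_⊎_; inj₁; inj₂)
open import Data.List using (List; length; filter; allFin)
open import Data.List.Membership.Propositional using (_∈_)
open import Data.List.Membership.Propositional.Properties using (∈-filter⁺; ∈-allFin)
open import Data.List.Membership.Setoid.Properties using (index-injective)
open import Function using (_∘_)
open import Function.Definitions using (Injective)
open import Relation.Nullary using (¬_; Dec; yes; no; contradiction)
open import Relation.Nullary.Decidable
  using (¬?; _×-dec_; _→-dec_; decidable-stable; map′; toWitness; True)
open import Relation.Unary using (Decidable)
open import Relation.Binary.PropositionalEquality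
  using (_≡_; _≢_; refl; sym; trans; cong; subst; subst₂; _≗_; setoid; module ≡-Reasoning)

private variable
  k n : ℕ

module _ {n : ℕ} (Adj : Fin n → Fin n → Set) where

  Colours : ∀ {k} → (Fin n → Fin k) → Fin n → Fin k → Set
  Colours c u x = ∃ λ w → InN Adj u w × c w ≡ x

  LidEdge : ∀ {k} → (Fin n → Fin k) → Fin n → Fin n → Set
  LidEdge c u w = c u ≢ c w × (¬ SameNbhd Adj u w → ¬ SameColours Adj c u w)

  isLid-fromEdges : ∀ {k} {c : Fin n → Fin k} → (∀ u w → Adj u w → LidEdge c u w) → IsLid Adj c
  isLid-fromEdges lid = (λ u w uw → proj₁ (lid u w uw)) , (λ u w uw → proj₂ (lid u w uw))

  sameNbhd-sym : ∀ {u w} → SameNbhd Adj u w → SameNbhd Adj w u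
  sameNbhd-sym same x = proj₂ (same x) , proj₁ (same x)

  sameColours-sym : ∀ {k} {c : Fin n → Fin k} {u w} → SameColours Adj c u w → SameColours Adj c w u
  sameColours-sym same x = proj₂ (same x) , proj₁ (same x)

  lidEdge-sym : ∀ {k} {c : Fin n → Fin k} {u w} → LidEdge c u w → LidEdge c w u
  lidEdge-sym (proper , separates) =
    (λ e → proper (sym e)) , λ ¬same same → separates (¬same ∘ sameNbhd-sym) (sameColours-sym same)

  ¬sameColours : ∀ {k} {c : Fin n → Fin k} {u w x} →
                 Colours c u x → ¬ Colours c w x → ¬ SameColours Adj c u w
  ¬sameColours x∈u x∉w same = x∉w (proj₁ (same _) x∈u)

LidColouring : (Fin n → Fin n → Set) → ℕ → Set
LidColouring {n} Adj k = Σ (Fin n → Fin k) (IsLid Adj)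

isLid-recolour : ∀ {k′} {Adj : Fin n → Fin n → Set} {c : Fin n → Fin k} (f : Fin k → Fin k′) →
                 Injective _≡_ _≡_ f → IsLid Adj c → IsLid Adj (f ∘ c)
isLid-recolour {Adj = Adj} {c} f f-inj (proper , lid) =
  (λ u w a → proper u w a ∘ f-inj) , λ u w a ¬same same → lid u w a ¬same λ x →
    unrecolour ∘ proj₁ (same (f x)) ∘ recolour , unrecolour ∘ proj₂ (same (f x)) ∘ recolour
  where
  recolour : ∀ {u x} → Colours Adj c u x → Colours Adj (f ∘ c) u (f x)
  recolour (w , w∈ , refl) = w , w∈ , refl
  unrecolour : ∀ {u x} → Colours Adj (f ∘ c) u (f x) → Colours Adj c u x
  unrecolour (w , w∈ , eq) = w , w∈ , f-inj eq

lidColouring-widen : ∀ {k′} {Adj : Fin n → Fin n → Set} →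
                     k ≤ k′ → LidColouring Adj k → LidColouring Adj k′
lidColouring-widen k≤k′ (c , lid) =
  (λ u → F.inject≤ (c u) k≤k′) , isLid-recolour _ (FP.inject≤-injective k≤k′ k≤k′ _ _) lid

chiLid-intro : {Adj : Fin n → Fin n → Set} → LidColouring Adj (suc k) →
               (∀ (c : Fin n → Fin k) → ¬ IsLid Adj c) → ChiLid Adj (suc k)
chiLid-intro coloured none = coloured , λ where
  m (s≤s m≤k) coloured′ → let c , lid = lidColouring-widen m≤k coloured′ in none c lid

-- The lid condition at an edge only involves the closed neighbourhoods of its ends.
module _ {m n k} (Adj : Fin n → Fin n → Set) (e : Fin m → Fin n) (e-inj : Injective _≡_ _≡_ e)
         (c : Fin n → Fin k) (c′ : Fin m → Fin k) where

  private
    Adj′ : Fin m → Fin m → Set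
    Adj′ x y = Adj (e x) (e y)

    inN-embed : ∀ {x z} → InN Adj (e x) (e z) → InN Adj′ x z
    inN-embed (inj₁ ez≡ex) = inj₁ (e-inj ez≡ex)
    inN-embed (inj₂ a) = inj₂ a

    inN-unembed : ∀ {x z} → InN Adj′ x z → InN Adj (e x) (e z)
    inN-unembed (inj₁ refl) = inj₁ refl
    inN-unembed (inj₂ a) = inj₂ a

  lidEdge-restrict : ∀ {u w} →
    (∀ z → InN Adj (e u) z ⊎ InN Adj (e w) z → ∃ λ z′ → e z′ ≡ z) →
    (∀ z′ → InN Adj (e u) (e z′) ⊎ InN Adj (e w) (e z′) → c (e z′) ≡ c′ z′) →
    LidEdge Adj′ c′ u w → LidEdge Adj c (e u) (e w)
  lidEdge-restrict {u} {w} onImage agree (proper′ , separates′) = proper , separates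
    where
    proper : c (e u) ≢ c (e w)
    proper eq = proper′ (trans (sym (agree u (inj₁ (inj₁ refl))))
                               (trans eq (agree w (inj₂ (inj₁ refl)))))

    nbhd : ∀ {x y} → (∀ z → InN Adj (e x) z → ∃ λ z′ → e z′ ≡ z) →
           (∀ z → InN Adj′ x z → InN Adj′ y z) → ∀ z → InN Adj (e x) z → InN Adj (e y) z
    nbhd onImg sub z z∈ with onImg z z∈
    ... | z′ , refl = inN-unembed (sub z′ (inN-embed z∈))

    colours : ∀ {x y} →
      (∀ z → InN Adj (e y) z → ∃ λ z′ → e z′ ≡ z) →
      (∀ z′ → InN Adj (e x) (e z′) → c (e z′) ≡ c′ z′) →
      (∀ z′ → InN Adj (e y) (e z′) → c (e z′) ≡ c′ z′) →
      (∀ a → Colours Adj c (e x) a → Colours Adj c (e y) a) →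
      ∀ a → Colours Adj′ c′ x a → Colours Adj′ c′ y a
    colours onImg agreeˣ agreeʸ sub a (z′ , z′∈ , cz′)
      with sub a (e z′ , inN-unembed z′∈ , trans (agreeˣ z′ (inN-unembed z′∈)) cz′)
    ... | z , z∈ , cz with onImg z z∈
    ...   | y′ , refl = y′ , inN-embed z∈ , trans (sym (agreeʸ y′ z∈)) cz

    separates : ¬ SameNbhd Adj (e u) (e w) → ¬ SameColours Adj c (e u) (e w)
    separates ¬same sameCol = separates′ ¬same′ sameCol′
      where
      ¬same′ : ¬ SameNbhd Adj′ u w
      ¬same′ same = ¬same λ z → nbhd (λ z → onImage z ∘ inj₁) (λ z → proj₁ (same z)) z
                              , nbhd (λ z → onImage z ∘ inj₂) (λ z → proj₂ (same z)) z
      sameCol′ : SameColours Adj′ c′ u w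
      sameCol′ a =
          colours (λ z → onImage z ∘ inj₂) (λ z → agree z ∘ inj₁) (λ z → agree z ∘ inj₂)
                  (proj₁ ∘ sameCol) a
        , colours (λ z → onImage z ∘ inj₁) (λ z → agree z ∘ inj₂) (λ z → agree z ∘ inj₁)
                  (proj₂ ∘ sameCol) a

fin2-≢⇒≡ : {x y z : Fin 2} → x ≢ z → y ≢ z → x ≡ y
fin2-≢⇒≡ {zero}     {zero}                x≢z y≢z = refl
fin2-≢⇒≡ {suc zero} {suc zero}            x≢z y≢z = refl
fin2-≢⇒≡ {zero}     {suc zero} {zero}     x≢z y≢z = contradiction refl x≢z
fin2-≢⇒≡ {zero}     {suc zero} {suc zero} x≢z y≢z = contradiction refl y≢z
fin2-≢⇒≡ {suc zero} {zero}     {zero}     x≢z y≢z = contradiction refl y≢z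
fin2-≢⇒≡ {suc zero} {zero}     {suc zero} x≢z y≢z = contradiction refl x≢z

-- Punching out x leaves Fin 2, in which z and w both avoid the image of y.
fin3-≢⇒≡ : {x y z w : Fin 3} → x ≢ y → x ≢ z → x ≢ w → z ≢ y → w ≢ y → z ≡ w
fin3-≢⇒≡ x≢y x≢z x≢w z≢y w≢y = FP.punchOut-injective x≢z x≢w
  (fin2-≢⇒≡ (z≢y ∘ FP.punchOut-injective x≢z x≢y) (w≢y ∘ FP.punchOut-injective x≢w x≢y))

∃-notInImage : ∀ {m} → m < n → (f : Fin m → Fin n) → ∃ λ x → ∀ i → f i ≢ x
∃-notInImage {n} {m} m<n f with any? (λ x → all? λ i → ¬? (f i ≟ x))
... | yes found = found
... | no none = contradiction (FP.injective⇒≤ preimage-injective) (ℕP.<⇒≱ m<n)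
  where
  preimage : ∀ x → ∃ λ i → f i ≡ x
  preimage x = decidable-stable (any? λ i → f i ≟ x) λ ¬pre →
    none (x , λ i fi≡x → ¬pre (i , fi≡x))
  preimage-injective : Injective _≡_ _≡_ (proj₁ ∘ preimage)
  preimage-injective {x} {y} eq = begin
    x                     ≡⟨ sym (proj₂ (preimage x)) ⟩
    f (proj₁ (preimage x)) ≡⟨ cong f eq ⟩
    f (proj₁ (preimage y)) ≡⟨ proj₂ (preimage y) ⟩
    y                     ∎
    where open ≡-Reasoning

injective-∈⇒≤ : ∀ {m} {A : Set} {xs : List A} (f : Fin m → A) → Injective _≡_ _≡_ f →
                (∀ i → f i ∈ xs) → m ≤ length xs
injective-∈⇒≤ f f-inj f∈ =
  FP.injective⇒≤ λ {i} {j} eq → f-inj (index-injective (setoid _) (f∈ i) (f∈ j) eq)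

∀-functions? : ∀ {m} {P : (Fin n → Fin m) → Set} → (∀ {f g} → f ≗ g → P f → P g) →
               (∀ f → Dec (P f)) → Dec (∀ f → P f)
∀-functions? {zero} resp P? = map′ (λ p f → resp (λ ()) p) (λ p → p _) (P? (λ ()))
∀-functions? {suc n} resp P? =
  map′ (λ p f → resp (λ { zero → refl ; (suc i) → refl }) (p (f zero) (f ∘ suc)))
       (λ p x g → p (x ∷ g))
       (all? λ x → ∀-functions? (λ g≗h → resp λ { zero → refl ; (suc i) → g≗h i })
                                (λ g → P? (x ∷ g)))

-- The cycle C_n

%-below-double : ∀ {m N} .{{_ : NonZero N}} → m < N + N → m % N ≡ m ⊎ N + m % N ≡ m
%-below-double {m} {N} m<2N with m ℕP.<? N
... | yes m<N = inj₁ (m<n⇒m%n≡m m<N)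
... | no m≮N = inj₂ (begin
  N + m % N         ≡⟨ cong (N +_) (sym (m≤n⇒[n∸m]%m≡n%m N≤m)) ⟩
  N + (m ∸ N) % N   ≡⟨ cong (N +_) (m<n⇒m%n≡m (ℕP.m<n+o⇒m∸n<o m N m<2N)) ⟩
  N + (m ∸ N)       ≡⟨ ℕP.m+[n∸m]≡n N≤m ⟩
  m                 ∎)
  where
  open ≡-Reasoning
  N≤m : N ≤ m
  N≤m = ℕP.≮⇒≥ m≮N

suc-% : ∀ m N .{{_ : NonZero N}} → suc (m % N) % N ≡ suc m % N
suc-% m N = begin
  (1 + m % N) % N            ≡⟨ %-distribˡ-+ 1 (m % N) N ⟩
  (1 % N + m % N % N) % N    ≡⟨ cong (λ r → (1 % N + r) % N) (m%n%n≡m%n m N) ⟩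
  (1 % N + m % N) % N        ≡⟨ %-distribˡ-+ 1 m N ⟨
  (1 + m) % N                ∎
  where open ≡-Reasoning

next : Fin (suc n) → Fin (suc n)
next {n} i = suc (toℕ i) mod suc n

next^ : ℕ → Fin (suc n) → Fin (suc n)
next^ zero    u = u
next^ (suc j) u = next (next^ j u)

toℕ-next^ : ∀ j (u : Fin (suc n)) → toℕ (next^ j u) ≡ (j + toℕ u) % suc n
toℕ-next^ {n} zero    u = sym (m<n⇒m%n≡m (FP.toℕ<n u))
toℕ-next^ {n} (suc j) u = begin
  toℕ (next (next^ j u))              ≡⟨ FP.toℕ-fromℕ< _ ⟩
  suc (toℕ (next^ j u)) % suc n       ≡⟨ cong (λ t → suc t % suc n) (toℕ-next^ j u) ⟩
  suc ((j + toℕ u) % suc n) % suc n   ≡⟨ suc-% (j + toℕ u) (suc n) ⟩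
  suc (j + toℕ u) % suc n             ∎
  where open ≡-Reasoning

next-spec : (i : Fin (suc n)) →
            toℕ (next i) ≡ suc (toℕ i) ⊎ (toℕ (next i) ≡ 0 × suc (toℕ i) ≡ suc n)
next-spec {n} i with ℕP.m≤n⇒m<n∨m≡n (FP.toℕ<n i)
... | inj₁ i+1<n = inj₁ (trans (toℕ-next^ 1 i) (m<n⇒m%n≡m i+1<n))
... | inj₂ i+1≡n =
  inj₂ (trans (toℕ-next^ 1 i) (trans (cong (_% suc n) i+1≡n) (n%n≡0 (suc n))) , i+1≡n)

next^-+ : ∀ a b (u : Fin (suc n)) → next^ (a + b) u ≡ next^ a (next^ b u)
next^-+ zero    b u = refl
next^-+ (suc a) b u = cong next (next^-+ a b u)

next^-≢ : ∀ {j} → 0 < j → j < suc n → (u : Fin (suc n)) → next^ j u ≢ u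
next^-≢ {n} {j} 0<j j<n u eq
  with %-below-double {j + toℕ u} {suc n} (ℕP.+-mono-< j<n (FP.toℕ<n u))
     | trans (sym (toℕ-next^ j u)) (cong toℕ eq)
... | inj₁ id   | j+u%n≡u =
  ℕP.<⇒≢ 0<j (sym (ℕP.+-cancelʳ-≡ (toℕ u) j 0 (trans (sym id) j+u%n≡u)))
... | inj₂ wrap | j+u%n≡u =
  ℕP.<⇒≢ j<n (ℕP.+-cancelʳ-≡ (toℕ u) j (suc n) (trans (sym wrap) (cong (suc n +_) j+u%n≡u)))

next^-period : (u : Fin (suc n)) → next^ (suc n) u ≡ u
next^-period {n} u = FP.toℕ-injective (begin
  toℕ (next^ (suc n) u)       ≡⟨ toℕ-next^ (suc n) u ⟩
  (suc n + toℕ u) % suc n     ≡⟨ cong (_% suc n) (ℕP.+-comm (suc n) (toℕ u)) ⟩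
  (toℕ u + suc n) % suc n     ≡⟨ [m+n]%n≡m%n (toℕ u) (suc n) ⟩
  toℕ u % suc n               ≡⟨ m<n⇒m%n≡m (FP.toℕ<n u) ⟩
  toℕ u                       ∎)
  where open ≡-Reasoning

next-surjective : (u : Fin (suc n)) → ∃ λ p → next p ≡ u
next-surjective {n} u = next^ n u , next^-period u

next-injective : {i j : Fin (suc n)} → next i ≡ next j → i ≡ j
next-injective {n} {i} {j} eq with next-spec i | next-spec j
... | inj₁ i+1 | inj₁ j+1 =
  FP.toℕ-injective (ℕP.suc-injective (trans (sym i+1) (trans (cong toℕ eq) j+1)))
... | inj₁ i+1 | inj₂ (j0 , _) = contradiction (trans (sym i+1) (trans (cong toℕ eq) j0)) λ ()
... | inj₂ (i0 , _) | inj₁ j+1 = contradiction (trans (sym j+1) (trans (cong toℕ (sym eq)) i0)) λ ()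
... | inj₂ (_ , i=n) | inj₂ (_ , j=n) = FP.toℕ-injective (ℕP.suc-injective (trans i=n (sym j=n)))

cycleAdj-next : (u : Fin (suc n)) → CycleAdj (suc n) u (next u)
cycleAdj-next u with next-spec u
... | inj₁ step = inj₁ step
... | inj₂ wrap = inj₂ (inj₂ (inj₂ wrap))

cycleAdj-sym : ∀ {u w : Fin n} → CycleAdj n u w → CycleAdj n w u
cycleAdj-sym (inj₁ e)                = inj₂ (inj₁ e)
cycleAdj-sym (inj₂ (inj₁ e))         = inj₁ e
cycleAdj-sym (inj₂ (inj₂ (inj₁ e))) = inj₂ (inj₂ (inj₂ e))
cycleAdj-sym (inj₂ (inj₂ (inj₂ e))) = inj₂ (inj₂ (inj₁ e))

next-unique : {u w : Fin (suc n)} →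
              toℕ w ≡ suc (toℕ u) ⊎ (toℕ w ≡ 0 × suc (toℕ u) ≡ suc n) → w ≡ next u
next-unique {n} {u} {w} w-after-u with next-spec u | w-after-u
... | inj₁ e         | inj₁ e′        = FP.toℕ-injective (trans e′ (sym e))
... | inj₂ (e , _)   | inj₂ (e′ , _)  = FP.toℕ-injective (trans e′ (sym e))
... | inj₁ e         | inj₂ (_ , u=n) = contradiction (FP.toℕ<n (next u)) (ℕP.<-irrefl (trans e u=n))
... | inj₂ (_ , u=n) | inj₁ e′        = contradiction (FP.toℕ<n w) (ℕP.<-irrefl (trans e′ u=n))

cycleAdj⇒next : {u w : Fin (suc n)} → CycleAdj (suc n) u w → w ≡ next u ⊎ u ≡ next w
cycleAdj⇒next (inj₁ e)                = inj₁ (next-unique (inj₁ e))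
cycleAdj⇒next (inj₂ (inj₁ e))         = inj₂ (next-unique (inj₁ e))
cycleAdj⇒next (inj₂ (inj₂ (inj₁ e))) = inj₂ (next-unique (inj₂ e))
cycleAdj⇒next (inj₂ (inj₂ (inj₂ e))) = inj₁ (next-unique (inj₂ e))

GoodWindow : Fin k → Fin k → Fin k → Fin k → Set
GoodWindow a b c d = a ≢ b × a ≢ d × ¬ (a ≡ c × b ≡ d)

goodWindow? : (a b c d : Fin k) → Dec (GoodWindow a b c d)
goodWindow? a b c d = ¬? (a ≟ b) ×-dec ¬? (a ≟ d) ×-dec ¬? (a ≟ c ×-dec b ≟ d)

goodWindow-by-decision : {a b c d : Fin k} → True (goodWindow? a b c d) → GoodWindow a b c d
goodWindow-by-decision {a = a} {b} {c} {d} = toWitness {a? = goodWindow? a b c d}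

goodWindow-≡ : {a a′ b b′ c c′ d d′ : Fin k} → a ≡ a′ → b ≡ b′ → c ≡ c′ → d ≡ d′ →
               GoodWindow a b c d → GoodWindow a′ b′ c′ d′
goodWindow-≡ refl refl refl refl good = good

OneOf : Fin k → Fin k → Fin k → Fin k → Set
OneOf a b c x = x ≡ a ⊎ x ≡ b ⊎ x ≡ c

oneOf-separated : {a b c d : Fin k} → GoodWindow a b c d → c ≢ d →
                  ¬ (∀ x → OneOf a b c x ⟺ OneOf b c d x)
oneOf-separated {a = a} {b} {c} {d} (a≢b , a≢d , ¬aba) c≢d same with a ≟ c
... | no a≢c with proj₁ (same a) (inj₁ refl)
...   | inj₁ a≡b = a≢b a≡b
...   | inj₂ (inj₁ a≡c) = a≢c a≡c
...   | inj₂ (inj₂ a≡d) = a≢d a≡d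
oneOf-separated {a = a} {b} {c} {d} (a≢b , a≢d , ¬aba) c≢d same | yes a≡c
  with proj₂ (same d) (inj₂ (inj₂ refl))
...   | inj₁ d≡a = a≢d (sym d≡a)
...   | inj₂ (inj₁ d≡b) = ¬aba (a≡c , sym d≡b)
...   | inj₂ (inj₂ d≡c) = c≢d (sym d≡c)

oneOf-same : {a b c d : Fin k} → a ≡ d ⊎ (a ≡ c × b ≡ d) →
             ∀ x → OneOf a b c x ⟺ OneOf b c d x
oneOf-same (inj₁ refl) x = rotate , rotate⁻¹
  where
  rotate : OneOf _ _ _ x → OneOf _ _ _ x
  rotate (inj₁ x≡a) = inj₂ (inj₂ x≡a)
  rotate (inj₂ (inj₁ x≡b)) = inj₁ x≡b
  rotate (inj₂ (inj₂ x≡c)) = inj₂ (inj₁ x≡c)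
  rotate⁻¹ : OneOf _ _ _ x → OneOf _ _ _ x
  rotate⁻¹ (inj₁ x≡b) = inj₂ (inj₁ x≡b)
  rotate⁻¹ (inj₂ (inj₁ x≡c)) = inj₂ (inj₂ x≡c)
  rotate⁻¹ (inj₂ (inj₂ x≡a)) = inj₁ x≡a
oneOf-same (inj₂ (refl , refl)) x = swap , swap
  where
  swap : ∀ {a b} → OneOf a b a x → OneOf b a b x
  swap (inj₁ x≡a) = inj₂ (inj₁ x≡a)
  swap (inj₂ (inj₁ x≡b)) = inj₁ x≡b
  swap (inj₂ (inj₂ x≡a)) = inj₂ (inj₁ x≡a)

CyclicLid : (Fin (suc n) → Fin k) → Set
CyclicLid c = ∀ u → GoodWindow (c u) (c (next u)) (c (next^ 2 u)) (c (next^ 3 u))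

cyclicLid? : (c : Fin (suc n) → Fin k) → Dec (CyclicLid c)
cyclicLid? c = all? λ u → goodWindow? _ _ _ _

cyclicLid-≗ : {c c′ : Fin (suc n) → Fin k} → c ≗ c′ → CyclicLid c → CyclicLid c′
cyclicLid-≗ c≗c′ good u = goodWindow-≡ (c≗c′ _) (c≗c′ _) (c≗c′ _) (c≗c′ _) (good u)

-- A cycle φ(0) ~ φ(1) ~ ⋯ ~ φ(k) ~ φ(0) that is a whole component of the graph.
module EmbeddedCycle {N k : ℕ} (Adj : Fin N → Fin N → Set) (adj-sym : ∀ {u w} → Adj u w → Adj w u)
  (φ : Fin (suc k) → Fin N) (φ-adj : ∀ i → Adj (φ i) (φ (next i)))
  (φ-nbrs : ∀ i {z} → Adj (φ (next i)) z → z ≡ φ i ⊎ z ≡ φ (next^ 2 i)) where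

  φ-closed : ∀ i {z} → InN Adj (φ i) z → ∃ λ l → z ≡ φ l
  φ-closed i (inj₁ z≡φi) = i , z≡φi
  φ-closed i (inj₂ a) with next-surjective i
  ... | p , refl with φ-nbrs p a
  ...   | inj₁ z≡φp = p , z≡φp
  ...   | inj₂ z≡φp+2 = next^ 2 p , z≡φp+2

  colours-φ : ∀ {m} (c : Fin N → Fin m) p {x} →
              Colours Adj c (φ (next p)) x ⟺ OneOf (c (φ p)) (c (φ (next p))) (c (φ (next^ 2 p))) x
  colours-φ c p = to , from
    where
    to : ∀ {x} → Colours Adj c (φ (next p)) x → OneOf _ _ _ x
    to (_ , inj₁ refl , refl) = inj₂ (inj₁ refl)
    to (_ , inj₂ a , refl) with φ-nbrs p a
    ... | inj₁ refl = inj₁ refl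
    ... | inj₂ refl = inj₂ (inj₂ refl)
    from : ∀ {x} → OneOf _ _ _ x → Colours Adj c (φ (next p)) x
    from (inj₁ refl) = φ p , inj₂ (adj-sym (φ-adj p)) , refl
    from (inj₂ (inj₁ refl)) = φ (next p) , inj₁ refl , refl
    from (inj₂ (inj₂ refl)) = φ (next^ 2 p) , inj₂ (φ-adj (next p)) , refl

  module _ {m} (c : Fin N → Fin m) (good : CyclicLid (c ∘ φ)) where

    lidEdge-φ : ∀ p → LidEdge Adj c (φ (next p)) (φ (next^ 2 p))
    lidEdge-φ p = proj₁ (good (next p)) , λ _ same →
      oneOf-separated (good p) (proj₁ (good (next^ 2 p))) λ x →
          proj₁ (colours-φ c (next p)) ∘ proj₁ (same x) ∘ proj₂ (colours-φ c p)
        , proj₁ (colours-φ c p) ∘ proj₂ (same x) ∘ proj₂ (colours-φ c (next p))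

    cyclicLid⇒lidEdge : ∀ i {z} → Adj (φ i) z → LidEdge Adj c (φ i) z
    cyclicLid⇒lidEdge i a with next-surjective i
    ... | p , refl with φ-nbrs p a
    ...   | inj₂ refl = lidEdge-φ p
    ...   | inj₁ refl with next-surjective p
    ...     | p′ , refl = lidEdge-sym Adj (lidEdge-φ p′)

cycle-nbrs : (i : Fin (suc n)) {z : Fin (suc n)} → CycleAdj (suc n) (next i) z → z ≡ i ⊎ z ≡ next^ 2 i
cycle-nbrs i a with cycleAdj⇒next a
... | inj₁ z≡i+2 = inj₂ z≡i+2
... | inj₂ i+1≡z+1 = inj₁ (sym (next-injective i+1≡z+1))

module CycleGraph (n : ℕ) =
  EmbeddedCycle (CycleAdj (suc n)) cycleAdj-sym (λ i → i) cycleAdj-next cycle-nbrs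

cyclicLid⇒isLid : {c : Fin (suc n) → Fin k} → CyclicLid c → IsLid (CycleAdj (suc n)) c
cyclicLid⇒isLid {n} {c = c} good = isLid-fromEdges _ λ u w → CycleGraph.cyclicLid⇒lidEdge n c good u

¬sameNbhd-next : 3 ≤ n → (u : Fin (suc n)) → ¬ SameNbhd (CycleAdj (suc n)) (next u) (next^ 2 u)
¬sameNbhd-next 3≤n u same with proj₁ (same u) (inj₂ (cycleAdj-sym (cycleAdj-next u)))
... | inj₁ u≡u+2 = next^-≢ (s≤s z≤n) (ℕP.<-≤-trans (ℕP.m≤m+n 3 _) (s≤s 3≤n)) u (sym u≡u+2)
... | inj₂ a with cycleAdj⇒next a
...   | inj₁ u≡u+3 = next^-≢ (s≤s z≤n) (s≤s 3≤n) u (sym u≡u+3)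
...   | inj₂ u+2≡u+1 =
  next^-≢ (s≤s z≤n) (ℕP.<-≤-trans (ℕP.m≤m+n 2 _) (s≤s 3≤n)) u (next-injective u+2≡u+1)

isLid⇒cyclicLid : 3 ≤ n → {c : Fin (suc n) → Fin k} → IsLid (CycleAdj (suc n)) c → CyclicLid c
isLid⇒cyclicLid {n} 3≤n {c} (proper , lid) u =
  proper u (next u) (cycleAdj-next u) , coincide ∘ inj₁ , coincide ∘ inj₂
  where
  open CycleGraph n using (colours-φ)
  coincide : c u ≡ c (next^ 3 u) ⊎ (c u ≡ c (next^ 2 u) × c (next u) ≡ c (next^ 3 u)) → ⊥
  coincide h = lid (next u) (next^ 2 u) (cycleAdj-next (next u)) (¬sameNbhd-next 3≤n u) λ x →
      proj₂ (colours-φ c (next u)) ∘ proj₁ (oneOf-same h x) ∘ proj₁ (colours-φ c u)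
    , proj₂ (colours-φ c u) ∘ proj₂ (oneOf-same h x) ∘ proj₁ (colours-φ c (next u))

-- Lower bounds for cycles

¬cyclicLid₂ : (c : Fin (suc n) → Fin 2) → ¬ CyclicLid c
¬cyclicLid₂ c good = proj₂ (proj₂ (good zero))
  ( fin2-≢⇒≡ (proj₁ (good zero)) (proj₁ (good (next zero)) ∘ sym)
  , fin2-≢⇒≡ (proj₁ (good (next zero))) (proj₁ (good (next^ 2 zero)) ∘ sym))

-- Either x₀ = x₂, and then x₄ and x₀ both avoid the distinct x₁ and x₃; or x₀ ≠ x₂, which forces
-- x₁ = x₃, and then x₄ and x₀ both avoid the distinct x₁ and x₂.
cyclicLid₃-period : {c : Fin (suc n) → Fin 3} → CyclicLid c → ∀ u → c (next^ 4 u) ≡ c u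
cyclicLid₃-period {c = c} good u = by-cases (x 0 ≟ x 2)
  where
  x : ℕ → Fin 3
  x j = c (next^ j u)
  x0≢x1 : x 0 ≢ x 1
  x0≢x1 = proj₁ (good u)
  x0≢x3 : x 0 ≢ x 3
  x0≢x3 = proj₁ (proj₂ (good u))
  ¬x0x1x0x1 : ¬ (x 0 ≡ x 2 × x 1 ≡ x 3)
  ¬x0x1x0x1 = proj₂ (proj₂ (good u))
  x1≢x2 : x 1 ≢ x 2
  x1≢x2 = proj₁ (good (next u))
  x1≢x4 : x 1 ≢ x 4
  x1≢x4 = proj₁ (proj₂ (good (next u)))
  ¬x1x2x1x2 : ¬ (x 1 ≡ x 3 × x 2 ≡ x 4)
  ¬x1x2x1x2 = proj₂ (proj₂ (good (next u)))
  x2≢x3 : x 2 ≢ x 3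
  x2≢x3 = proj₁ (good (next^ 2 u))
  x3≢x4 : x 3 ≢ x 4
  x3≢x4 = proj₁ (good (next^ 3 u))
  by-cases : Dec (x 0 ≡ x 2) → x 4 ≡ x 0
  by-cases (yes x0≡x2) =
    fin3-≢⇒≡ (λ x1≡x3 → ¬x0x1x0x1 (x0≡x2 , x1≡x3)) x1≢x4 (x0≢x1 ∘ sym) (x3≢x4 ∘ sym) x0≢x3
  by-cases (no x0≢x2) =
    fin3-≢⇒≡ x1≢x2 x1≢x4 (x0≢x1 ∘ sym) (λ x4≡x2 → ¬x1x2x1x2 (x1≡x3 , sym x4≡x2)) x0≢x2
    where
    x1≡x3 : x 1 ≡ x 3
    x1≡x3 = fin3-≢⇒≡ x0≢x2 x0≢x1 x0≢x3 x1≢x2 (x2≢x3 ∘ sym)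

¬cyclicLid₃ : suc n % 4 ≢ 0 → (c : Fin (suc n) → Fin 3) → ¬ CyclicLid c
¬cyclicLid₃ {n} r≢0 c good = excluded (suc n % 4) r≢0 (m%n<n (suc n) 4) period-r
  where
  open ≡-Reasoning
  q r : ℕ
  q = suc n / 4
  r = suc n % 4
  q*4+r≡n : q * 4 + r ≡ suc n
  q*4+r≡n = trans (ℕP.+-comm (q * 4) r) (sym (m≡m%n+[m/n]*n (suc n) 4))

  period-4q : ∀ q u → c (next^ (q * 4) u) ≡ c u
  period-4q zero    u = refl
  period-4q (suc q) u = begin
    c (next^ (4 + q * 4) u)          ≡⟨ cong c (next^-+ 4 (q * 4) u) ⟩
    c (next^ 4 (next^ (q * 4) u))    ≡⟨ cyclicLid₃-period good (next^ (q * 4) u) ⟩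
    c (next^ (q * 4) u)              ≡⟨ period-4q q u ⟩
    c u                              ∎

  period-r : ∀ u → c (next^ r u) ≡ c u
  period-r u = begin
    c (next^ r u)                 ≡⟨ period-4q q (next^ r u) ⟨
    c (next^ (q * 4) (next^ r u)) ≡⟨ cong c (next^-+ (q * 4) r u) ⟨
    c (next^ (q * 4 + r) u)       ≡⟨ cong (λ j → c (next^ j u)) q*4+r≡n ⟩
    c (next^ (suc n) u)           ≡⟨ cong c (next^-period u) ⟩
    c u                           ∎

  excluded : ∀ r → r ≢ 0 → r < 4 → (∀ u → c (next^ r u) ≡ c u) → ⊥
  excluded 0 r≢0 _ _ = r≢0 refl
  excluded 1 _ _ period = proj₁ (good zero) (sym (period zero))
  excluded 2 _ _ period = proj₂ (proj₂ (good zero)) (sym (period zero) , sym (period (next zero)))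
  excluded 3 _ _ period = proj₁ (proj₂ (good zero)) (sym (period zero))
  excluded (suc (suc (suc (suc _)))) _ (s≤s (s≤s (s≤s (s≤s ())))) _

¬cyclicLid? : ∀ n k → Dec (∀ (c : Fin (suc n) → Fin k) → ¬ CyclicLid c)
¬cyclicLid? n k =
  ∀-functions? (λ f≗g ¬good → ¬good ∘ cyclicLid-≗ (sym ∘ f≗g)) (¬? ∘ cyclicLid?)

¬cyclicLid₄-C5 : (c : Fin 5 → Fin 4) → ¬ CyclicLid c
¬cyclicLid₄-C5 = toWitness {a? = ¬cyclicLid? 4 4} _

¬cyclicLid₄-C7 : (c : Fin 7 → Fin 4) → ¬ CyclicLid c
¬cyclicLid₄-C7 = toWitness {a? = ¬cyclicLid? 6 4} _

GoodWindowAt : (ℕ → Fin k) → ℕ → Set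
GoodWindowAt f m = GoodWindow (f m) (f (1 + m)) (f (2 + m)) (f (3 + m))

-- f(0), …, f(N - 1) read around C_N: windows starting near the end read on into f(N), f(N + 1), f(N + 2).
CyclicWord : ℕ → (ℕ → Fin k) → Set
CyclicWord N f = (∀ {m} → m < N → GoodWindowAt f m) × (∀ {r} → r < 3 → f (N + r) ≡ f r)

cyclicWord? : ∀ N (f : ℕ → Fin k) → Dec (CyclicWord N f)
cyclicWord? N f = ℕP.allUpTo? (λ m → goodWindow? _ _ _ _) N
           ×-dec ℕP.allUpTo? (λ r → f (N + r) ≟ f r) 3

cyclicWord⇒cyclicLid : 3 ≤ n → {f : ℕ → Fin k} → CyclicWord (suc n) f → CyclicLid (f ∘ toℕ)
cyclicWord⇒cyclicLid {n} 3≤n {f} (windows , wraps) u =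
  goodWindow-≡ refl (read 1 (ℕP.m≤m+n 1 2)) (read 2 (ℕP.m≤m+n 2 1)) (read 3 ℕP.≤-refl)
               (windows (FP.toℕ<n u))
  where
  read : ∀ j → j ≤ 3 → f (j + toℕ u) ≡ f (toℕ (next^ j u))
  read j j≤3
    with %-below-double {j + toℕ u} {suc n} (ℕP.+-mono-< (s≤s (ℕP.≤-trans j≤3 3≤n)) (FP.toℕ<n u))
  ... | inj₁ id = cong f (trans (sym id) (sym (toℕ-next^ j u)))
  ... | inj₂ wrap = trans (cong f (sym wrap)) (trans (wraps r<3) (cong f (sym (toℕ-next^ j u))))
    where
    r<3 : (j + toℕ u) % suc n < 3
    r<3 = ℕP.+-cancelˡ-< (suc n) _ 3
      (subst₂ _<_ (sym wrap) (ℕP.+-comm 3 (suc n)) (ℕP.+-mono-≤-< j≤3 (FP.toℕ<n u)))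

Starts010 : (ℕ → Fin (3 + k)) → Set
Starts010 f = f 0 ≡ # 0 × f 1 ≡ # 1 × f 2 ≡ # 0

pad : (ℕ → Fin (3 + k)) → ℕ → Fin (3 + k)
pad f 0 = # 0
pad f 1 = # 1
pad f 2 = # 0
pad f 3 = # 2
pad f (suc (suc (suc (suc m)))) = f m

pad-cyclicWord : ∀ {N} {f : ℕ → Fin (3 + k)} →
                 Starts010 f → CyclicWord N f → CyclicWord (4 + N) (pad f)
pad-cyclicWord {N = N} {f} (f0 , f1 , f2) (windows , wraps) = windows′ , wraps′
  where
  windows′ : ∀ {m} → m < 4 + N → GoodWindowAt (pad f) m
  windows′ {0} _ = goodWindow-by-decision _
  windows′ {1} _ = goodWindow-≡ refl refl refl (sym f0) (goodWindow-by-decision _)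
  windows′ {2} _ = goodWindow-≡ refl refl (sym f0) (sym f1) (goodWindow-by-decision _)
  windows′ {3} _ = goodWindow-≡ refl (sym f0) (sym f1) (sym f2) (goodWindow-by-decision _)
  windows′ {suc (suc (suc (suc m)))} (s≤s (s≤s (s≤s (s≤s m<N)))) = windows m<N
  wraps′ : ∀ {r} → r < 3 → pad f (4 + N + r) ≡ pad f r
  wraps′ {0} r<3 = trans (wraps r<3) f0
  wraps′ {1} r<3 = trans (wraps r<3) f1
  wraps′ {2} r<3 = trans (wraps r<3) f2
  wraps′ {suc (suc (suc _))} (s≤s (s≤s (s≤s ())))

padded : ℕ → (ℕ → Fin (3 + k)) → ℕ → Fin (3 + k)
padded zero    f = f
padded (suc a) f = pad (padded a f)

padded-cyclicWord : ∀ {N} {f : ℕ → Fin (3 + k)} → Starts010 f → CyclicWord N f →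
                    ∀ a → CyclicWord (a * 4 + N) (padded a f)
padded-cyclicWord start word zero    = word
padded-cyclicWord start word (suc a) = pad-cyclicWord (starts a) (padded-cyclicWord start word a)
  where
  starts : ∀ a → Starts010 (padded a _)
  starts zero    = start
  starts (suc a) = refl , refl , refl

cyclicWord⇒lidColouring : ∀ {N} {f : ℕ → Fin k} → 4 ≤ N → CyclicWord N f → LidColouring (CycleAdj N) k
cyclicWord⇒lidColouring {f = f} (s≤s 3≤n) word =
  f ∘ toℕ , cyclicLid⇒isLid (cyclicWord⇒cyclicLid 3≤n word)

padded-lidColouring : ∀ {t} {f : ℕ → Fin (3 + k)} → 4 ≤ t → Starts010 f → CyclicWord t f →
                      ∀ a → LidColouring (CycleAdj (t + a * 4)) (3 + k)
padded-lidColouring {k} {t} 4≤t start word a =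
  subst (λ N → LidColouring (CycleAdj N) (3 + k)) (ℕP.+-comm (a * 4) t)
    (cyclicWord⇒lidColouring (ℕP.≤-trans 4≤t (ℕP.m≤n+m t (a * 4))) (padded-cyclicWord start word a))

periodic : ∀ {t} {A : Set} → (Fin (suc t) → A) → ℕ → A
periodic v m = v (m mod _)

-- Seeds: C_(4a + t) is coloured by (0102)^a word_t.
word₄ : ℕ → Fin 3
word₄ = periodic (# 0 ∷ # 1 ∷ # 0 ∷ # 2 ∷ [])

word₆ : ℕ → Fin 4
word₆ = periodic (# 0 ∷ # 1 ∷ # 0 ∷ # 2 ∷ # 0 ∷ # 3 ∷ [])

word₉ : ℕ → Fin 4
word₉ = periodic (# 0 ∷ # 1 ∷ # 0 ∷ # 2 ∷ # 0 ∷ # 1 ∷ # 3 ∷ # 2 ∷ # 3 ∷ [])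

word₁₁ : ℕ → Fin 4
word₁₁ = periodic (# 0 ∷ # 1 ∷ # 0 ∷ # 2 ∷ # 0 ∷ # 1 ∷ # 3 ∷ # 1 ∷ # 2 ∷ # 0 ∷ # 3 ∷ [])

word₅ : ℕ → Fin 5
word₅ = periodic (# 0 ∷ # 1 ∷ # 2 ∷ # 3 ∷ # 4 ∷ [])

word₇ : ℕ → Fin 5
word₇ = periodic (# 0 ∷ # 1 ∷ # 0 ∷ # 2 ∷ # 3 ∷ # 2 ∷ # 4 ∷ [])

lidColouring₃ : ∀ {N} q → N ≡ q * 4 → 4 ≤ N → LidColouring (CycleAdj N) 3
lidColouring₃ zero    refl ()
lidColouring₃ (suc a) refl _ =
  padded-lidColouring ℕP.≤-refl (refl , refl , refl) (toWitness {a? = cyclicWord? 4 word₄} _) a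

lidColouring₄ : ∀ {N} r q → N ≡ r + q * 4 → r < 4 → r ≢ 0 → N ≢ 5 → N ≢ 7 → 4 ≤ N →
                LidColouring (CycleAdj N) 4
lidColouring₄ 0 _ _ _ r≢0 _ _ _ = contradiction refl r≢0
lidColouring₄ 1 0 refl _ _ _ _ (s≤s ())
lidColouring₄ 1 1 refl _ _ N≢5 _ _ = contradiction refl N≢5
lidColouring₄ 1 (suc (suc a)) refl _ _ _ _ _ =
  padded-lidColouring (ℕP.m≤m+n 4 _) (refl , refl , refl) (toWitness {a? = cyclicWord? 9 word₉} _) a
lidColouring₄ 2 0 refl _ _ _ _ (s≤s (s≤s ()))
lidColouring₄ 2 (suc a) refl _ _ _ _ _ =
  padded-lidColouring (ℕP.m≤m+n 4 _) (refl , refl , refl) (toWitness {a? = cyclicWord? 6 word₆} _) a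
lidColouring₄ 3 0 refl _ _ _ _ (s≤s (s≤s (s≤s ())))
lidColouring₄ 3 1 refl _ _ _ N≢7 _ = contradiction refl N≢7
lidColouring₄ 3 (suc (suc a)) refl _ _ _ _ _ =
  padded-lidColouring (ℕP.m≤m+n 4 _) (refl , refl , refl) (toWitness {a? = cyclicWord? 11 word₁₁} _) a
lidColouring₄ (suc (suc (suc (suc _)))) _ _ (s≤s (s≤s (s≤s (s≤s ())))) _ _ _ _

chiLid-cycle : ∀ N → 4 ≤ N →
    (N % 4 ≡ 0 → ChiLid (CycleAdj N) 3)
  × ((N ≡ 5 ⊎ N ≡ 7) → ChiLid (CycleAdj N) 5)
  × (N % 4 ≢ 0 → N ≢ 5 → N ≢ 7 → ChiLid (CycleAdj N) 4)
chiLid-cycle N@(suc n) 4≤N@(s≤s 3≤n) = three , five , four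
  where
  N≡r+q*4 : N ≡ N % 4 + N / 4 * 4
  N≡r+q*4 = m≡m%n+[m/n]*n N 4
  three : N % 4 ≡ 0 → ChiLid (CycleAdj N) 3
  three r≡0 = chiLid-intro (lidColouring₃ (N / 4) (trans N≡r+q*4 (cong (_+ N / 4 * 4) r≡0)) 4≤N)
                           λ c → ¬cyclicLid₂ c ∘ isLid⇒cyclicLid 3≤n
  four : N % 4 ≢ 0 → N ≢ 5 → N ≢ 7 → ChiLid (CycleAdj N) 4
  four r≢0 N≢5 N≢7 =
    chiLid-intro (lidColouring₄ (N % 4) (N / 4) N≡r+q*4 (m%n<n N 4) r≢0 N≢5 N≢7 4≤N)
                 λ c → ¬cyclicLid₃ r≢0 c ∘ isLid⇒cyclicLid 3≤n
  five : N ≡ 5 ⊎ N ≡ 7 → ChiLid (CycleAdj N) 5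
  five (inj₁ refl) = chiLid-intro (cyclicWord⇒lidColouring 4≤N (toWitness {a? = cyclicWord? 5 word₅} _))
                                  λ c → ¬cyclicLid₄-C5 c ∘ isLid⇒cyclicLid 3≤n
  five (inj₂ refl) = chiLid-intro (cyclicWord⇒lidColouring 4≤N (toWitness {a? = cyclicWord? 7 word₇} _))
                                  λ c → ¬cyclicLid₄-C7 c ∘ isLid⇒cyclicLid 3≤n

lidColouring-cycle₅ : ∀ N → 4 ≤ N → LidColouring (CycleAdj N) 5
lidColouring-cycle₅ N 4≤N with chiLid-cycle N 4≤N | N % 4 ℕ.≟ 0 | N ℕ.≟ 5 | N ℕ.≟ 7
... | three , _ , _ | yes r≡0 | _ | _ = lidColouring-widen (ℕP.m≤m+n 3 _) (proj₁ (three r≡0))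
... | _ , five , _ | no _ | yes N≡5 | _ = proj₁ (five (inj₁ N≡5))
... | _ , five , _ | no _ | no _ | yes N≡7 = proj₁ (five (inj₂ N≡7))
... | _ , _ , four | no r≢0 | no N≢5 | no N≢7 =
  lidColouring-widen (ℕP.m≤m+n 4 _) (proj₁ (four r≢0 N≢5 N≢7))

-- Graphs of maximum degree at most two

AtMostTwoNeighbours : (Fin n → Fin n → Set) → Set
AtMostTwoNeighbours Adj = ∀ {u a b z} → Adj u a → Adj u b → a ≢ b → Adj u z → z ≡ a ⊎ z ≡ b

degree≤2⇒atMostTwoNeighbours : {Adj : Fin n → Fin n → Set} (adj? : ∀ u → Decidable (Adj u)) →
                               (∀ u → degree Adj adj? u ≤ 2) → AtMostTwoNeighbours Adj
degree≤2⇒atMostTwoNeighbours {n} {Adj} adj? deg≤2 {u} {a} {b} {z} ua ub a≢b uz with z ≟ a | z ≟ b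
... | yes z≡a | _       = inj₁ z≡a
... | no _    | yes z≡b = inj₂ z≡b
... | no z≢a  | no z≢b  =
  contradiction (deg≤2 u) (ℕP.<⇒≱ (injective-∈⇒≤ (a ∷ b ∷ z ∷ []) distinct neighbour))
  where
  neighbour : ∀ i → (a ∷ b ∷ z ∷ []) i ∈ filter (adj? u) (allFin n)
  neighbour zero             = ∈-filter⁺ (adj? u) (∈-allFin a) ua
  neighbour (suc zero)       = ∈-filter⁺ (adj? u) (∈-allFin b) ub
  neighbour (suc (suc zero)) = ∈-filter⁺ (adj? u) (∈-allFin z) uz
  distinct : Injective _≡_ _≡_ (a ∷ b ∷ z ∷ [])
  distinct {zero}           {zero}           _   = refl
  distinct {zero}           {suc zero}       a≡b = contradiction a≡b a≢b
  distinct {zero}           {suc (suc zero)} a≡z = contradiction (sym a≡z) z≢a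
  distinct {suc zero}       {zero}           b≡a = contradiction (sym b≡a) a≢b
  distinct {suc zero}       {suc zero}       _   = refl
  distinct {suc zero}       {suc (suc zero)} b≡z = contradiction (sym b≡z) z≢b
  distinct {suc (suc zero)} {zero}           z≡a = contradiction z≡a z≢a
  distinct {suc (suc zero)} {suc zero}       z≡b = contradiction z≡b z≢b
  distinct {suc (suc zero)} {suc (suc zero)} _   = refl

record Degree≤2Graph (n : ℕ) : Set₁ where
  field
    Adj        : Fin n → Fin n → Set
    adj?       : ∀ u → Decidable (Adj u)
    adj-sym    : ∀ {u w} → Adj u w → Adj w u
    adj-irrefl : ∀ {u} → ¬ Adj u u
    ≤2-nbrs    : AtMostTwoNeighbours Adj

  adj⇒≢ : ∀ {u w} → Adj u w → u ≢ w
  adj⇒≢ uw refl = adj-irrefl uw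

  Lone : Fin n → Set
  Lone v = ∀ a b → Adj v a → Adj v b → a ≡ b

  lone? : ∀ v → Dec (Lone v)
  lone? v = all? λ a → all? λ b → adj? v a →-dec (adj? v b →-dec (a ≟ b))

  ¬lone⇒two : ∀ {v} → ¬ Lone v → ∃ λ a → ∃ λ b → Adj v a × Adj v b × a ≢ b
  ¬lone⇒two {v} ¬lone =
    decidable-stable (any? λ a → any? λ b → adj? v a ×-dec adj? v b ×-dec ¬? (a ≟ b)) λ ¬two →
      ¬lone λ a b va vb → decidable-stable (a ≟ b) λ a≢b → ¬two (a , b , va , vb , a≢b)

  other-nbr-unique : ∀ {q p r r′} →
                     Adj q p → Adj q r → Adj q r′ → r ≢ p → r′ ≢ p → r ≡ r′
  other-nbr-unique qp qr qr′ r≢p r′≢p with ≤2-nbrs qp qr (r≢p ∘ sym) qr′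
  ... | inj₁ r′≡p = contradiction r′≡p r′≢p
  ... | inj₂ r′≡r = sym r′≡r

deleteVertex : Degree≤2Graph (suc n) → Fin (suc n) → Degree≤2Graph n
deleteVertex G v = record
  { Adj        = λ x y → Adj (punchIn v x) (punchIn v y)
  ; adj?       = λ x y → adj? (punchIn v x) (punchIn v y)
  ; adj-sym    = adj-sym
  ; adj-irrefl = adj-irrefl
  ; ≤2-nbrs    = λ ua ub a≢b uz →
      Sum.map (FP.punchIn-injective v _ _) (FP.punchIn-injective v _ _)
                   (≤2-nbrs ua ub (a≢b ∘ FP.punchIn-injective v _ _) uz)
  }
  where open Degree≤2Graph G

module Recolour (G : Degree≤2Graph (suc n)) (v : Fin (suc n))
  (c′ : Fin n → Fin 5) (lid′ : IsLid (Degree≤2Graph.Adj (deleteVertex G v)) c′)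
  {S : Fin (suc n) → Set} (S? : Decidable S) (v∈S : S v) (new : Fin (suc n) → Fin 5) where

  open Degree≤2Graph G

  ∉S⇒≢v : ∀ {w} → ¬ S w → v ≢ w
  ∉S⇒≢v w∉S v≡w = w∉S (subst S v≡w v∈S)

  colour : Fin (suc n) → Fin 5
  colour w with S? w
  ... | yes _   = new w
  ... | no w∉S = c′ (punchOut (∉S⇒≢v w∉S))

  colour-∈S : ∀ {w} → S w → colour w ≡ new w
  colour-∈S {w} w∈S with S? w
  ... | yes _   = refl
  ... | no w∉S = contradiction w∈S w∉S

  colour-∉S : ∀ {w} (v≢w : v ≢ w) → ¬ S w → colour w ≡ c′ (punchOut v≢w)
  colour-∉S {w} v≢w w∉S with S? w
  ... | yes w∈S = contradiction w∈S w∉S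
  ... | no _    = cong c′ (FP.punchOut-cong v refl)

  colour-punchIn : ∀ {z} → ¬ S (punchIn v z) → colour (punchIn v z) ≡ c′ z
  colour-punchIn {z} z∉S = trans (colour-∉S (∉S⇒≢v z∉S) z∉S)
                                 (cong c′ (trans (FP.punchOut-cong v refl) (FP.punchOut-punchIn v)))

  punchIn-view : ∀ {w} → ¬ S w → ∃ λ z → punchIn v z ≡ w
  punchIn-view w∉S = punchOut (∉S⇒≢v w∉S) , FP.punchIn-punchOut (∉S⇒≢v w∉S)

  colour-proper : ∀ {w₁ w₂} → ¬ S w₁ → ¬ S w₂ → Adj w₁ w₂ → colour w₁ ≢ colour w₂
  colour-proper w₁∉S w₂∉S a with punchIn-view w₁∉S | punchIn-view w₂∉S
  ... | z₁ , refl | z₂ , refl =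
    proj₁ lid′ z₁ z₂ a ∘ subst₂ _≡_ (colour-punchIn w₁∉S) (colour-punchIn w₂∉S)

  lidEdge-outside : ∀ {u w} → (∀ {z} → InN Adj u z → ¬ S z) → (∀ {z} → InN Adj w z → ¬ S z) →
                    Adj u w → LidEdge Adj colour u w
  lidEdge-outside {u} {w} u-out w-out uw
    with punchIn-view (u-out (inj₁ refl)) | punchIn-view (w-out (inj₁ refl))
  ... | zu , refl | zw , refl =
    lidEdge-restrict Adj (punchIn v) (FP.punchIn-injective v _ _) colour c′
      (λ z z∈ → punchIn-view (out z∈)) (λ z z∈ → colour-punchIn (out z∈))
      (proj₁ lid′ zu zw uw , proj₂ lid′ zu zw uw)
    where
    out : ∀ {z} → InN Adj (punchIn v zu) z ⊎ InN Adj (punchIn v zw) z → ¬ S z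
    out (inj₁ z∈) = u-out z∈
    out (inj₂ z∈) = w-out z∈

module LoneNeighbour (G : Degree≤2Graph (suc n)) (v : Fin (suc n))
  (lone : ∀ {a b} → Degree≤2Graph.Adj G v a → Degree≤2Graph.Adj G v b → a ≡ b)
  (c′ : Fin n → Fin 5) (lid′ : IsLid (Degree≤2Graph.Adj (deleteVertex G v)) c′) where

  open Degree≤2Graph G

  module R (x : Fin 5) = Recolour G v c′ lid′ (_≟ v) refl (λ _ → x)

  far-from-v : ∀ {u} → u ≢ v → ¬ Adj u v → ∀ {z} → InN Adj u z → z ≢ v
  far-from-v u≢v _   (inj₁ z≡u) z≡v = u≢v (trans (sym z≡u) z≡v)
  far-from-v _   ¬uv (inj₂ uz)  refl = ¬uv uz

  isolated : (∀ a → ¬ Adj v a) → LidColouring Adj 5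
  isolated ¬va = R.colour zero , isLid-fromEdges Adj λ u w uw →
    R.lidEdge-outside zero (far-from-v (away uw) (¬va u ∘ adj-sym))
                           (far-from-v (away (adj-sym uw)) (¬va w ∘ adj-sym)) uw
    where
    away : ∀ {u w} → Adj u w → u ≢ v
    away {w = w} uw refl = ¬va w uw

  module WithNeighbour {a} (va : Adj v a) where

    a≢v : a ≢ v
    a≢v = adj⇒≢ va ∘ sym

    -- Walks v a l z of length 1 to 3 that do not turn back.
    data Near : Fin (suc n) → Set where
      near₁ : Near a
      near₂ : ∀ {l} → Adj a l → l ≢ v → Near l
      near₃ : ∀ {l z} → Adj a l → l ≢ v → Adj l z → z ≢ a → Near z

    near⇒≢v : ∀ {z} → Near z → z ≢ v
    near⇒≢v near₁ = a≢v
    near⇒≢v (near₂ _ l≢v) = l≢v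
    near⇒≢v (near₃ al _ lz _) refl = adj⇒≢ al (lone va (adj-sym lz))

    onward-unique : ∀ {l l′} → Adj a l → l ≢ v → Adj a l′ → l′ ≢ v → l′ ≡ l
    onward-unique al l≢v al′ l′≢v = other-nbr-unique (adj-sym va) al′ al l′≢v l≢v

    near-cover : ∃ λ b → ∃ λ c → ∃ λ d → ∀ {z} → Near z → OneOf b c d z
    near-cover with any? (λ l → adj? a l ×-dec ¬? (l ≟ v))
    ... | no ¬l = a , a , a , cover
      where
      cover : ∀ {z} → Near z → OneOf a a a z
      cover near₁ = inj₁ refl
      cover (near₂ al l≢v) = contradiction (_ , al , l≢v) ¬l
      cover (near₃ al l≢v _ _) = contradiction (_ , al , l≢v) ¬l
    ... | yes (l , al , l≢v) with any? (λ m → adj? l m ×-dec ¬? (m ≟ a))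
    ...   | no ¬m = a , l , l , cover
      where
      cover : ∀ {z} → Near z → OneOf a l l z
      cover near₁ = inj₁ refl
      cover (near₂ al′ l′≢v) = inj₂ (inj₁ (onward-unique al l≢v al′ l′≢v))
      cover (near₃ al′ l′≢v l′z z≢a) with onward-unique al l≢v al′ l′≢v
      ... | refl = contradiction (_ , l′z , z≢a) ¬m
    ...   | yes (m , lm , m≢a) = a , l , m , cover
      where
      cover : ∀ {z} → Near z → OneOf a l m z
      cover near₁ = inj₁ refl
      cover (near₂ al′ l′≢v) = inj₂ (inj₁ (onward-unique al l≢v al′ l′≢v))
      cover (near₃ al′ l′≢v l′z z≢a) with onward-unique al l≢v al′ l′≢v
      ... | refl = inj₂ (inj₂ (other-nbr-unique (adj-sym al) l′z lm z≢a m≢a))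

    -- Away from v the colouring does not depend on the colour of v, so compute with colour 0.
    avoiding : ∃ λ x → ∀ {z} → Near z → R.colour zero z ≢ x
    avoiding with near-cover
    ... | b , c , d , cover
      with ∃-notInImage (ℕP.m≤m+n 4 _) (R.colour zero b ∷ R.colour zero c ∷ R.colour zero d ∷ [])
    ...   | x , fresh = x , avoided ∘ cover
      where
      avoided : ∀ {z} → OneOf b c d z → R.colour zero z ≢ x
      avoided (inj₁ refl) = fresh zero
      avoided (inj₂ (inj₁ refl)) = fresh (suc zero)
      avoided (inj₂ (inj₂ refl)) = fresh (suc (suc zero))

    module Coloured (x : Fin 5) (x-fresh : ∀ {z} → Near z → R.colour zero z ≢ x) where

      open R x public using (colour)
      open R x using (colour-∈S; colour-∉S; colour-proper; lidEdge-outside)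

      near-colour : ∀ {z} → Near z → colour z ≢ x
      near-colour near = x-fresh near ∘ trans (trans (R.colour-∉S zero v≢z z≢v) (sym (colour-∉S v≢z z≢v)))
        where
        z≢v : _ ≢ v
        z≢v = near⇒≢v near
        v≢z : v ≢ _
        v≢z = z≢v ∘ sym

      lidEdge-v : ∀ {w} → Adj v w → LidEdge Adj colour v w
      lidEdge-v vw with lone va vw
      ... | refl = (λ eq → near-colour near₁ (trans (sym eq) (colour-∈S refl))) , separates
        where
        separates : ¬ SameNbhd Adj v a → ¬ SameColours Adj colour v a
        separates ¬same with any? (λ l → adj? a l ×-dec ¬? (l ≟ v))
        ... | yes (l , al , l≢v) = ¬sameColours Adj (l , inj₂ al , refl) l∉N[v] ∘ sameColours-sym Adj
          where
          l∉N[v] : ¬ Colours Adj colour v (colour l)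
          l∉N[v] (z , inj₁ refl , eq) = near-colour (near₂ al l≢v) (trans (sym eq) (colour-∈S refl))
          l∉N[v] (z , inj₂ vz , eq) with lone va vz
          ... | refl = colour-proper a≢v l≢v al eq
        ... | no ¬l = contradiction (λ z → to , from) ¬same
          where
          to : ∀ {z} → InN Adj v z → InN Adj a z
          to (inj₁ refl) = inj₂ (adj-sym va)
          to (inj₂ vz) = inj₁ (sym (lone va vz))
          from : ∀ {z} → InN Adj a z → InN Adj v z
          from (inj₁ refl) = inj₂ va
          from {z} (inj₂ az) with z ≟ v
          ... | yes z≡v = inj₁ z≡v
          ... | no z≢v = contradiction (z , az , z≢v) ¬l

      lidEdge-beside : ∀ {u w} → Adj u v → w ≢ v → Adj u w → LidEdge Adj colour u w
      lidEdge-beside uv w≢v uw with lone va (adj-sym uv)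
      ... | refl = colour-proper a≢v w≢v uw
                 , λ _ → ¬sameColours Adj (v , inj₂ (adj-sym va) , colour-∈S refl) x∉N[w]
        where
        x∉N[w] : ¬ Colours Adj colour _ x
        x∉N[w] (z , inj₁ refl , cz) = near-colour (near₂ uw w≢v) cz
        x∉N[w] (z , inj₂ wz , cz) with z ≟ a
        ... | yes refl = near-colour near₁ cz
        ... | no z≢a = near-colour (near₃ uw w≢v wz z≢a) cz

      lidEdge : ∀ u w → Adj u w → LidEdge Adj colour u w
      lidEdge u w uw with v ≟ u | v ≟ w
      ... | yes refl | _        = lidEdge-v uw
      ... | no _     | yes refl = lidEdge-sym Adj (lidEdge-v (adj-sym uw))
      ... | no v≢u   | no v≢w with adj? u v | adj? w v
      ...   | yes uv | _      = lidEdge-beside uv (v≢w ∘ sym) uw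
      ...   | no _   | yes wv = lidEdge-sym Adj (lidEdge-beside wv (v≢u ∘ sym) (adj-sym uw))
      ...   | no ¬uv | no ¬wv =
        lidEdge-outside (far-from-v (v≢u ∘ sym) ¬uv) (far-from-v (v≢w ∘ sym) ¬wv) uw

  lidColouring : LidColouring Adj 5
  lidColouring with any? (adj? v)
  ... | yes (a , va) = colour , isLid-fromEdges Adj lidEdge
    where open WithNeighbour va
          open Coloured (proj₁ avoiding) (proj₂ avoiding)
  ... | no ¬va = isolated λ a va → ¬va (a , va)

record CycleIn (G : Degree≤2Graph n) (k : ℕ) : Set where
  open Degree≤2Graph G
  field
    φ           : Fin (suc k) → Fin n
    φ-injective : Injective _≡_ _≡_ φ
    φ-adj       : ∀ i → Adj (φ i) (φ (next i))

  φ-nbrs : 2 ≤ k → ∀ i {z} → Adj (φ (next i)) z → z ≡ φ i ⊎ z ≡ φ (next^ 2 i)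
  φ-nbrs 2≤k i a = ≤2-nbrs (adj-sym (φ-adj i)) (φ-adj (next i))
                           (next^-≢ (s≤s z≤n) (s≤s 2≤k) i ∘ sym ∘ φ-injective) a

-- In a graph where every vertex has two distinct neighbours, walking on without turning back
-- from vertex 0 returns to 0 along a cycle.
module Walk (G : Degree≤2Graph (suc n))
  (two : ∀ v → ∃ λ a → ∃ λ b → Degree≤2Graph.Adj G v a × Degree≤2Graph.Adj G v b × a ≢ b) where

  open Degree≤2Graph G

  onward : ∀ p q → ∃ λ r → Adj q r × r ≢ p
  onward p q with two q
  ... | a , b , qa , qb , a≢b with a ≟ p
  ...   | no a≢p   = a , qa , a≢p
  ...   | yes refl = b , qb , a≢b ∘ sym

  steps : ℕ → Fin (suc n) × Fin (suc n)
  steps zero    = zero , proj₁ (two zero)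
  steps (suc j) = proj₂ (steps j) , proj₁ (onward (proj₁ (steps j)) (proj₂ (steps j)))

  walk : ℕ → Fin (suc n)
  walk j = proj₁ (steps j)

  walk-adj : ∀ j → Adj (walk j) (walk (suc j))
  walk-adj zero    = proj₁ (proj₂ (proj₂ (two zero)))
  walk-adj (suc j) = proj₁ (proj₂ (onward (walk j) (walk (suc j))))

  walk-turns : ∀ j → walk (2 + j) ≢ walk j
  walk-turns j = proj₂ (proj₂ (onward (walk j) (walk (suc j))))

  walk-nbrs : ∀ j {z} → Adj (walk (suc j)) z → z ≡ walk j ⊎ z ≡ walk (2 + j)
  walk-nbrs j = ≤2-nbrs (adj-sym (walk-adj j)) (walk-adj (suc j)) (walk-turns j ∘ sym)

  SimpleBelow : ℕ → Set
  SimpleBelow k = ∀ {i j} → i < k → j < k → walk i ≡ walk j → i ≡ j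

  simple₁ : SimpleBelow 1
  simple₁ (s≤s z≤n) (s≤s z≤n) _ = refl

  simple-step : ∀ {j} → SimpleBelow (suc j) → walk (suc j) ≢ walk 0 → SimpleBelow (2 + j)
  simple-step {j} simple new≢0 = extended
    where
    new : ∀ {i} → i < suc j → walk (suc j) ≢ walk i
    new {zero} _ = new≢0
    new {suc i} (s≤s i<j) eq with ℕP.m≤n⇒m<n∨m≡n i<j
    ... | inj₂ refl = adj⇒≢ (walk-adj j) (sym eq)
    ... | inj₁ i+1<j with walk-nbrs i (subst (λ y → Adj y (walk j)) eq (adj-sym (walk-adj j)))
    ...   | inj₁ j≈i = ℕP.<⇒≢ i<j (sym (simple (ℕP.n<1+n j) (ℕP.m<n⇒m<1+n i<j) j≈i))
    ...   | inj₂ j≈i+2 with simple (ℕP.n<1+n j) (s≤s i+1<j) j≈i+2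
    ...     | refl = walk-turns (suc i) eq
    extended : SimpleBelow (2 + j)
    extended i<  j<  eq with ℕP.m<1+n⇒m<n∨m≡n i< | ℕP.m<1+n⇒m<n∨m≡n j<
    ... | inj₁ i<′ | inj₁ j<′ = simple i<′ j<′ eq
    ... | inj₂ refl | inj₂ refl = refl
    ... | inj₂ refl | inj₁ j<′ = contradiction eq (new j<′)
    ... | inj₁ i<′ | inj₂ refl = contradiction (sym eq) (new i<′)

  ¬simple-beyond : ¬ SimpleBelow (2 + n)
  ¬simple-beyond simple with FP.pigeonhole (ℕP.n<1+n (suc n)) (walk ∘ toℕ)
  ... | i , j , i<j , eq = ℕP.<⇒≢ i<j (simple (FP.toℕ<n i) (FP.toℕ<n j) eq)

  first-return : ∀ fuel j → fuel + j ≡ suc n → SimpleBelow (suc j) →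
                 ∃ λ k → 3 ≤ k × walk k ≡ zero × SimpleBelow k
  first-return fuel j _ simple with walk (suc j) ≟ zero
  first-return fuel 0 _ simple | yes back = contradiction (sym back) (adj⇒≢ (walk-adj 0))
  first-return fuel 1 _ simple | yes back = contradiction back (walk-turns 0)
  first-return fuel (suc (suc j)) _ simple | yes back = 3 + j , ℕP.m≤m+n 3 j , back , simple
  first-return zero j refl simple | no _ = ⊥-elim (¬simple-beyond simple)
  first-return (suc fuel) j fuel+j+1≡n simple | no away =
    first-return fuel (suc j) (trans (ℕP.+-suc fuel j) fuel+j+1≡n) (simple-step simple away)

  cycleThroughZero : ∃ λ k → 2 ≤ k × Σ (CycleIn G k) λ C → CycleIn.φ C zero ≡ zero
  cycleThroughZero with first-return (suc n) 0 (ℕP.+-identityʳ (suc n)) simple₁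
  ... | suc k , s≤s 2≤k , back , simple = k , 2≤k , cycle , refl
    where
    cycle : CycleIn G k
    cycle = record
      { φ           = walk ∘ toℕ
      ; φ-injective = FP.toℕ-injective ∘ simple (FP.toℕ<n _) (FP.toℕ<n _)
      ; φ-adj       = adj
      }
      where
      adj : ∀ i → Adj (walk (toℕ i)) (walk (toℕ (next i)))
      adj i with next-spec i
      ... | inj₁ step = subst (Adj (walk (toℕ i)) ∘ walk) (sym step) (walk-adj (toℕ i))
      ... | inj₂ (wrap , i+1≡k) = subst (Adj (walk (toℕ i)))
        (trans (cong walk i+1≡k) (trans back (cong walk (sym wrap)))) (walk-adj (toℕ i))

module OnCycle (G : Degree≤2Graph (suc n)) {k} (C : CycleIn G k) (2≤k : 2 ≤ k)
  (φ0 : CycleIn.φ C zero ≡ zero)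
  (c′ : Fin n → Fin 5) (lid′ : IsLid (Degree≤2Graph.Adj (deleteVertex G zero)) c′)
  (d : Fin (suc k) → Fin 5) where

  open Degree≤2Graph G
  open CycleIn C
  open EmbeddedCycle Adj adj-sym φ φ-adj (φ-nbrs 2≤k) using (φ-closed; cyclicLid⇒lidEdge)

  OnCycle : Fin (suc n) → Set
  OnCycle w = ∃ λ i → φ i ≡ w

  onCycle? : Decidable OnCycle
  onCycle? w = any? λ i → φ i ≟ w

  cycleColour : Fin (suc n) → Fin 5
  cycleColour w with onCycle? w
  ... | yes (i , _) = d i
  ... | no _        = zero

  open Recolour G zero c′ lid′ onCycle? (zero , φ0) cycleColour public using (colour)
  open Recolour G zero c′ lid′ onCycle? (zero , φ0) cycleColour using (colour-∈S; lidEdge-outside)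

  colour-φ : ∀ i → colour (φ i) ≡ d i
  colour-φ i = trans (colour-∈S (i , refl)) cycleColour-φ
    where
    cycleColour-φ : cycleColour (φ i) ≡ d i
    cycleColour-φ with onCycle? (φ i)
    ... | yes (j , φj≡φi) = cong d (φ-injective φj≡φi)
    ... | no none         = contradiction (i , refl) none

  off-cycle : ∀ {u} → ¬ OnCycle u → ∀ {z} → InN Adj u z → ¬ OnCycle z
  off-cycle u∉ (inj₁ z≡u) (i , φi≡z) = u∉ (i , trans φi≡z z≡u)
  off-cycle u∉ (inj₂ uz) (i , refl) with φ-closed i (inj₂ (adj-sym uz))
  ... | l , u≡φl = u∉ (l , sym u≡φl)

  isLid-fromCycle : (∀ i {z} → Adj (φ i) z → LidEdge Adj colour (φ i) z) → IsLid Adj colour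
  isLid-fromCycle on-cycle = isLid-fromEdges Adj λ u w uw → by-cases (onCycle? u) (onCycle? w) uw
    where
    by-cases : ∀ {u w} → Dec (OnCycle u) → Dec (OnCycle w) → Adj u w → LidEdge Adj colour u w
    by-cases (yes (i , refl)) _               uw = on-cycle i uw
    by-cases (no _)           (yes (i , refl)) uw = lidEdge-sym Adj (on-cycle i (adj-sym uw))
    by-cases (no u∉)          (no w∉)          uw = lidEdge-outside (off-cycle u∉) (off-cycle w∉) uw

  isLid-cyclicLid : CyclicLid d → IsLid Adj colour
  isLid-cyclicLid good = isLid-fromCycle (cyclicLid⇒lidEdge colour (cyclicLid-≗ (sym ∘ colour-φ) good))

  isLid-sameNbhd : (∀ i j → SameNbhd Adj (φ i) (φ j)) → Injective _≡_ _≡_ d → IsLid Adj colour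
  isLid-sameNbhd same d-inj = isLid-fromCycle on-cycle
    where
    on-cycle : ∀ i {z} → Adj (φ i) z → LidEdge Adj colour (φ i) z
    on-cycle i a with φ-closed i (inj₂ a)
    ... | l , refl = (λ eq → adj⇒≢ a (cong φ (d-inj (trans (sym (colour-φ i)) (trans eq (colour-φ l))))))
                   , λ ¬same → contradiction (same i l) ¬same

triangle-sameNbhd : {G : Degree≤2Graph n} (C : CycleIn G 2) →
                    ∀ i j → SameNbhd (Degree≤2Graph.Adj G) (CycleIn.φ C i) (CycleIn.φ C j)
triangle-sameNbhd {G = G} C i j z = within i j , within j i
  where
  open Degree≤2Graph G
  open CycleIn C
  open EmbeddedCycle Adj adj-sym φ φ-adj (φ-nbrs ℕP.≤-refl) using (φ-closed)
  any-two : ∀ i l → InN Adj (φ i) (φ l)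
  any-two zero             zero             = inj₁ refl
  any-two zero             (suc zero)       = inj₂ (φ-adj zero)
  any-two zero             (suc (suc zero)) = inj₂ (adj-sym (φ-adj (suc (suc zero))))
  any-two (suc zero)       zero             = inj₂ (adj-sym (φ-adj zero))
  any-two (suc zero)       (suc zero)       = inj₁ refl
  any-two (suc zero)       (suc (suc zero)) = inj₂ (φ-adj (suc zero))
  any-two (suc (suc zero)) zero             = inj₂ (φ-adj (suc (suc zero)))
  any-two (suc (suc zero)) (suc zero)       = inj₂ (adj-sym (φ-adj (suc zero)))
  any-two (suc (suc zero)) (suc (suc zero)) = inj₁ refl
  within : ∀ i j → InN Adj (φ i) z → InN Adj (φ j) z
  within i j z∈ with φ-closed i z∈
  ... | l , refl = any-two j l

-- The cycle through 0 is a whole component: recolour it, keep the colouring of G - 0 elsewhere.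
lidColouring-onCycle : (G : Degree≤2Graph (suc n)) →
  (∀ v → ∃ λ a → ∃ λ b → Degree≤2Graph.Adj G v a × Degree≤2Graph.Adj G v b × a ≢ b) →
  LidColouring (Degree≤2Graph.Adj (deleteVertex G zero)) 5 → LidColouring (Degree≤2Graph.Adj G) 5
lidColouring-onCycle G two (c′ , lid′) with Walk.cycleThroughZero G two
... | 0 , () , _
... | 1 , s≤s () , _
... | 2 , 2≤2 , C , φ0 = colour , isLid-sameNbhd (triangle-sameNbhd C) (FP.inject≤-injective _ _ _ _)
  where open OnCycle G C 2≤2 φ0 c′ lid′ (λ i → F.inject≤ i (ℕP.m≤m+n 3 2))
... | suc (suc (suc k)) , 2≤k , C , φ0 = colour , isLid-cyclicLid (isLid⇒cyclicLid 3≤k+3 (proj₂ cycleColouring))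
  where
  3≤k+3 : 3 ≤ 3 + k
  3≤k+3 = ℕP.m≤m+n 3 k
  cycleColouring : LidColouring (CycleAdj (4 + k)) 5
  cycleColouring = lidColouring-cycle₅ (4 + k) (s≤s 3≤k+3)
  open OnCycle G C 2≤k φ0 c′ lid′ (proj₁ cycleColouring)

lidColouring-degree≤2 : (G : Degree≤2Graph n) → LidColouring (Degree≤2Graph.Adj G) 5
lidColouring-degree≤2 {zero} G = (λ ()) , (λ ()) , (λ ())
lidColouring-degree≤2 {suc n} G with any? (Degree≤2Graph.lone? G)
... | yes (v , lone) = LoneNeighbour.lidColouring G v (lone _ _) (proj₁ coloured) (proj₂ coloured)
  where
  coloured : LidColouring (Degree≤2Graph.Adj (deleteVertex G v)) 5
  coloured = lidColouring-degree≤2 (deleteVertex G v)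
... | no ¬lone = lidColouring-onCycle G (λ v → Degree≤2Graph.¬lone⇒two G (¬lone ∘ (v ,_)))
                                       (lidColouring-degree≤2 (deleteVertex G zero))

mainTheorem4 :
    (∀ (n : ℕ) → 4 ≤ n →
        (n % 4 ≡ 0 → ChiLid (CycleAdj n) 3)
      × ((n ≡ 5 ⊎ n ≡ 7) → ChiLid (CycleAdj n) 5)
      × (n % 4 ≢ 0 → n ≢ 5 → n ≢ 7 → ChiLid (CycleAdj n) 4))
    × (∀ (n : ℕ) (Adj : Fin n → Fin n → Set) (adj? : (u : Fin n) → Decidable (Adj u)) →
        (∀ u v → Adj u v → Adj v u) →
        (∀ u → ¬ Adj u u) →
        MaxDegree Adj adj? 2 →
        Σ (Fin n → Fin 5) (IsLid Adj))
mainTheorem4 = chiLid-cycle , λ n Adj adj? sym′ irrefl (degree≤2 , _) → lidColouring-degree≤2 record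
  { Adj        = Adj
  ; adj?       = adj?
  ; adj-sym    = sym′ _ _
  ; adj-irrefl = irrefl _
  ; ≤2-nbrs    = degree≤2⇒atMostTwoNeighbours adj? degree≤2
  }
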